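{- For all $n\geq 1$ and all formulas $\varphi,\chi_1,\dots,\chi_n\in\mathcal{L}(\nabla,\bullet)$, $$\vdash_{\mathbf{K}^{\nabla\bullet}}\Delta\Big(\bigwedge_{k=1}^n\chi_k\to\varphi\Big)\land\bigwedge_{k=1}^n\Delta\chi_k\land\bigwedge_{k=1}^n\circ(\varphi\to\chi_k)\to\varphi\vee\Delta\varphi.$$
   Context: Fix a nonempty set $\mathbf{P}$ of propositional variables. $\mathcal{L}(\nabla,\bullet)$: $\varphi::=p\mid\neg\varphi\mid\varphi\land\varphi\mid\nabla\varphi\mid\bullet\varphi$ ($p\in\mathbf{P}$), with $\Delta\varphi:=\neg\nabla\varphi$, $\circ\varphi:=\neg\bullet\varphi$. The system $\mathbf{K}^{\nabla\bullet}$ has axioms: A0 all propositional tautologies; A1 $\bullet\varphi\to\varphi$; A2 $\nabla\varphi\leftrightarrow\nabla\neg\varphi$; A3 $\bullet(\psi\to\varphi)\land\varphi\to\bullet\varphi$; A4 $\nabla(\varphi\land\psi)\to\nabla\varphi\vee\nabla\psi$; A5 $\bullet(\varphi\land\psi)\to\bullet\varphi\vee\bullet\psi$; A6 $\nabla\varphi\to\bullet\varphi\vee\bullet\neg\varphi$; A7 $\bullet(\varphi\to\psi)\land\bullet(\neg\varphi\to\chi)\to\nabla\varphi$; rules: from $\varphi$ infer $\Delta\varphi$; from $\varphi$ infer $\circ\varphi$; from $\varphi\leftrightarrow\psi$ infer $\Delta\varphi\leftrightarrow\Delta\psi$; from $\varphi\leftrightarrow\psi$ infer $\circ\varphi\leftrightarrow\circ\psi$;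 modus ponens. -}

module Defs where

open import Data.Bool using (Bool; true; false; not; _∧_)
open import Data.Nat using (ℕ; suc)
open import Data.Vec using (Vec; _∷_; [])
open import Relation.Binary.PropositionalEquality using (_≡_)

data Form (P : Set) : Set where
  var  : P → Form P
  ¬'_  : Form P → Form P
  _∧'_ : Form P → Form P → Form P
  ∇_   : Form P → Form P
  •_   : Form P → Form P

infix 8 ¬'_ ∇_ •_
infixr 6 _∧'_

module _ {P : Set} where
  infix 8 Δ_ ∘_
  infixr 5 _∨'_
  infixr 4 _⇒_ _⇔_
  infix 2 ⊢_

  _∨'_ : Form P → Form P → Form P
  φ ∨' ψ = ¬' (¬' φ ∧' ¬' ψ)

  _⇒_ : Form P → Form P → Form P
  φ ⇒ ψ = ¬' (φ ∧' ¬' ψ)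

  _⇔_ : Form P → Form P → Form P
  φ ⇔ ψ = (φ ⇒ ψ) ∧' (ψ ⇒ φ)

  Δ_ : Form P → Form P
  Δ φ = ¬' (∇ φ)

  ∘_ : Form P → Form P
  ∘ φ = ¬' (• φ)

  eval : (Form P → Bool) → Form P → Bool
  eval v (var p)  = v (var p)
  eval v (¬' φ)   = not (eval v φ)
  eval v (φ ∧' ψ) = eval v φ ∧ eval v ψ
  eval v (∇ φ)    = v (∇ φ)
  eval v (• φ)    = v (• φ)

  -- propositional tautology (substitution instance of a classical tautology)
  Tautology : Form P → Set
  Tautology φ = (v : Form P → Bool) → eval v φ ≡ true

  data ⊢_ : Form P → Set where
    A0  : ∀ {φ} → Tautology φ → ⊢ φ
    A1  : ∀ φ → ⊢ (• φ ⇒ φ)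
    A2  : ∀ φ → ⊢ (∇ φ ⇔ ∇ (¬' φ))
    A3  : ∀ φ ψ → ⊢ ((• (ψ ⇒ φ) ∧' φ) ⇒ • φ)
    A4  : ∀ φ ψ → ⊢ (∇ (φ ∧' ψ) ⇒ (∇ φ ∨' ∇ ψ))
    A5  : ∀ φ ψ → ⊢ (• (φ ∧' ψ) ⇒ (• φ ∨' • ψ))
    A6  : ∀ φ → ⊢ (∇ φ ⇒ (• φ ∨' • (¬' φ)))
    A7  : ∀ φ ψ χ → ⊢ ((• (φ ⇒ ψ) ∧' • (¬' φ ⇒ χ)) ⇒ ∇ φ)
    NecΔ : ∀ {φ} → ⊢ φ → ⊢ (Δ φ)
    Nec∘ : ∀ {φ} → ⊢ φ → ⊢ (∘ φ)
    REΔ  : ∀ {φ ψ} → ⊢ (φ ⇔ ψ) → ⊢ (Δ φ ⇔ Δ ψ)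
    RE∘  : ∀ {φ ψ} → ⊢ (φ ⇔ ψ) → ⊢ (∘ φ ⇔ ∘ ψ)
    MP   : ∀ {φ ψ} → ⊢ (φ ⇒ ψ) → ⊢ φ → ⊢ ψ

  ⋀ : ∀ {n} → Vec (Form P) (suc n) → Form P
  ⋀ (χ ∷ [])     = χ
  ⋀ (χ ∷ χ' ∷ χs) = χ ∧' ⋀ (χ' ∷ χs)

  map⋀ : ∀ {n} → (Form P → Form P) → Vec (Form P) (suc n) → Form P
  map⋀ f (χ ∷ [])      = f χ
  map⋀ f (χ ∷ χ' ∷ χs) = f χ ∧' map⋀ f (χ' ∷ χs)

-- Write c for ⋀ χ. The hypotheses Δ(c → φ) and Δχₖ give Δ(c ∧ (c → φ)), i.e. Δ(c ∧ φ),
-- because noncontingency is closed under conjunction (A4) and provable equivalence. The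
-- hypotheses ∘(φ → χₖ) give ∘(φ → c) by A5. Now if φ holds, then φ → c is a true formula
-- that is not known to be true, hence it is noncontingent (A6 with A1); and φ is a Boolean
-- combination of c ∧ φ and φ → c, so Δφ. Thus φ ∨ Δφ.
module Submission where

open import Defs
open import Data.Bool using (Bool; true; false; not; _∧_; T)
open import Data.Bool.Properties using (T-∧; T-≡)
open import Data.Fin using (Fin; #_)
open import Data.Nat using (ℕ; suc)
import Data.Nat as ℕ
open import Data.Product using (proj₁; proj₂)
open import Data.Vec using (Vec; _∷_; []; lookup; map)
open import Data.Vec.Properties using (lookup-map)
open import Function using (_∘′_; Equivalence)
open import Relation.Binary.PropositionalEquality using (_≡_; sym; trans; cong; cong₂)
open import Relation.Nullary.Decidable using (True)

open Equivalence using (to)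

data Schema (n : ℕ) : Set where
  atom : Fin n → Schema n
  ~_   : Schema n → Schema n
  _&_  : Schema n → Schema n → Schema n

infix 10 ‵_
infix 8 ~_
infixr 6 _&_
infixr 5 _∨∨_
infixr 4 _⟹_ _⟺_

‵_ : ∀ m {n} {m<n : True (m ℕ.<? n)} → Schema n
‵_ m {m<n = m<n} = atom (#_ m {m<n = m<n})

-- The derived connectives mirror those of Defs, so instances agree definitionally.
_∨∨_ _⟹_ _⟺_ : ∀ {n} → Schema n → Schema n → Schema n
s ∨∨ t = ~ (~ s & ~ t)
s ⟹ t = ~ (s & ~ t)
s ⟺ t = (s ⟹ t) & (t ⟹ s)

⟦_⟧ : ∀ {n} → Schema n → Vec Bool n → Bool
⟦ atom i ⟧ ρ = lookup ρ i
⟦ ~ s ⟧    ρ = not (⟦ s ⟧ ρ)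
⟦ s & t ⟧  ρ = ⟦ s ⟧ ρ ∧ ⟦ t ⟧ ρ

allValuations : ∀ n → (Vec Bool n → Bool) → Bool
allValuations ℕ.zero  f = f []
allValuations (suc n) f = allValuations n (f ∘′ (true ∷_)) ∧ allValuations n (f ∘′ (false ∷_))

allValuations-sound : ∀ n (f : Vec Bool n → Bool) → T (allValuations n f) → ∀ ρ → T (f ρ)
allValuations-sound ℕ.zero  f ok []          = ok
allValuations-sound (suc n) f ok (true ∷ ρ)  = allValuations-sound n _ (proj₁ (to T-∧ ok)) ρ
allValuations-sound (suc n) f ok (false ∷ ρ) = allValuations-sound n _ (proj₂ (to T-∧ ok)) ρ

valid : ∀ {n} → Schema n → Bool
valid {n} s = allValuations n ⟦ s ⟧

module _ {P : Set} where

  infix 9 _[_]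

  _[_] : ∀ {n} → Schema n → Vec (Form P) n → Form P
  atom i  [ φs ] = lookup φs i
  (~ s)   [ φs ] = ¬' (s [ φs ])
  (s & t) [ φs ] = s [ φs ] ∧' t [ φs ]

  eval-[] : ∀ {n} (v : Form P → Bool) (s : Schema n) (φs : Vec (Form P) n) →
            eval v (s [ φs ]) ≡ ⟦ s ⟧ (map (eval v) φs)
  eval-[] v (atom i) φs = sym (lookup-map i (eval v) φs)
  eval-[] v (~ s)    φs = cong not (eval-[] v s φs)
  eval-[] v (s & t)  φs = cong₂ _∧_ (eval-[] v s φs) (eval-[] v t φs)

  -- For a concrete valid schema the implicit argument has type ⊤ and is filled in by Agda,
  -- so an instance of A0 costs only naming the schema and its atoms.
  taut : ∀ {n} (s : Schema n) {_ : T (valid s)} (φs : Vec (Form P) n) → ⊢ s [ φs ]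
  taut {n} s {ok} φs = A0 λ v →
    trans (eval-[] v s φs) (to T-≡ (allValuations-sound n ⟦ s ⟧ ok (map (eval v) φs)))

  infixr 3 _⨾_

  ⇒-refl : ∀ {a : Form P} → ⊢ (a ⇒ a)
  ⇒-refl {a} = taut (‵ 0 ⟹ ‵ 0) (a ∷ [])

  _⨾_ : ∀ {a b c : Form P} → ⊢ (a ⇒ b) → ⊢ (b ⇒ c) → ⊢ (a ⇒ c)
  _⨾_ {a} {b} {c} p q = MP (MP (taut ((‵ 0 ⟹ ‵ 1) ⟹ (‵ 1 ⟹ ‵ 2) ⟹ ‵ 0 ⟹ ‵ 2) (a ∷ b ∷ c ∷ [])) p) q

  ⇔⇒ : ∀ {a b : Form P} → ⊢ (a ⇔ b) → ⊢ (a ⇒ b)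
  ⇔⇒ {a} {b} = MP (taut ((‵ 0 ⟺ ‵ 1) ⟹ ‵ 0 ⟹ ‵ 1) (a ∷ b ∷ []))

  ∧-elimˡ : ∀ {a b : Form P} → ⊢ (a ∧' b ⇒ a)
  ∧-elimˡ {a} {b} = taut (‵ 0 & ‵ 1 ⟹ ‵ 0) (a ∷ b ∷ [])

  ∧-elimʳ : ∀ {a b : Form P} → ⊢ (a ∧' b ⇒ b)
  ∧-elimʳ {a} {b} = taut (‵ 0 & ‵ 1 ⟹ ‵ 1) (a ∷ b ∷ [])

  ⇒-∧ : ∀ {a b c : Form P} → ⊢ (a ⇒ b) → ⊢ (a ⇒ c) → ⊢ (a ⇒ b ∧' c)
  ⇒-∧ {a} {b} {c} p q = MP (MP (taut ((‵ 0 ⟹ ‵ 1) ⟹ (‵ 0 ⟹ ‵ 2) ⟹ ‵ 0 ⟹ ‵ 1 & ‵ 2) (a ∷ b ∷ c ∷ [])) p) q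

  ∧-mapˡ : ∀ {a b c : Form P} → ⊢ (a ⇒ b) → ⊢ (a ∧' c ⇒ b ∧' c)
  ∧-mapˡ p = ⇒-∧ (∧-elimˡ ⨾ p) ∧-elimʳ

  ∧-mapʳ : ∀ {a b c : Form P} → ⊢ (b ⇒ c) → ⊢ (a ∧' b ⇒ a ∧' c)
  ∧-mapʳ p = ⇒-∧ ∧-elimˡ (∧-elimʳ ⨾ p)

  Δ-∧ : ∀ (a b : Form P) → ⊢ (Δ a ∧' Δ b ⇒ Δ (a ∧' b))
  Δ-∧ a b = MP (taut ((‵ 0 ⟹ ‵ 1 ∨∨ ‵ 2) ⟹ ~ ‵ 1 & ~ ‵ 2 ⟹ ~ ‵ 0) (∇ (a ∧' b) ∷ ∇ a ∷ ∇ b ∷ [])) (A4 a b)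

  Δ-¬ : ∀ (a : Form P) → ⊢ (Δ a ⇒ Δ (¬' a))
  Δ-¬ a = MP (taut ((‵ 0 ⟺ ‵ 1) ⟹ ~ ‵ 0 ⟹ ~ ‵ 1) (∇ a ∷ ∇ (¬' a) ∷ [])) (A2 a)

  Δ-cong : ∀ {a b : Form P} → ⊢ (a ⇔ b) → ⊢ (Δ a ⇒ Δ b)
  Δ-cong e = ⇔⇒ (REΔ e)

  ∘-∧ : ∀ (a b : Form P) → ⊢ (∘ a ∧' ∘ b ⇒ ∘ (a ∧' b))
  ∘-∧ a b = MP (taut ((‵ 0 ⟹ ‵ 1 ∨∨ ‵ 2) ⟹ ~ ‵ 1 & ~ ‵ 2 ⟹ ~ ‵ 0) (• (a ∧' b) ∷ • a ∷ • b ∷ [])) (A5 a b)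

  ∘-cong : ∀ {a b : Form P} → ⊢ (a ⇔ b) → ⊢ (∘ a ⇒ ∘ b)
  ∘-cong e = ⇔⇒ (RE∘ e)

  -- A6 and A1: a contingent truth would be known, or its negation would be known and hence true.
  ∘∧⇒Δ : ∀ (a : Form P) → ⊢ (∘ a ∧' a ⇒ Δ a)
  ∘∧⇒Δ a = MP (MP (taut ((‵ 0 ⟹ ‵ 1 ∨∨ ‵ 2) ⟹ (‵ 2 ⟹ ~ ‵ 3) ⟹ ~ ‵ 1 & ‵ 3 ⟹ ~ ‵ 0)
                         (∇ a ∷ • a ∷ • (¬' a) ∷ a ∷ []))
                  (A6 a))
              (A1 (¬' a))

  Δ-⋀ : ∀ {n} (χ : Vec (Form P) (suc n)) → ⊢ (map⋀ Δ_ χ ⇒ Δ (⋀ χ))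
  Δ-⋀ (χ ∷ [])      = ⇒-refl
  Δ-⋀ (χ ∷ χ' ∷ χs) = ∧-mapʳ (Δ-⋀ (χ' ∷ χs)) ⨾ Δ-∧ χ (⋀ (χ' ∷ χs))

  ∘⇒-⋀ : ∀ {n} (φ : Form P) (χ : Vec (Form P) (suc n)) →
         ⊢ (map⋀ (λ c → ∘ (φ ⇒ c)) χ ⇒ ∘ (φ ⇒ ⋀ χ))
  ∘⇒-⋀ φ (χ ∷ [])      = ⇒-refl
  ∘⇒-⋀ φ (χ ∷ χ' ∷ χs) =
    ∧-mapʳ (∘⇒-⋀ φ (χ' ∷ χs)) ⨾ ∘-∧ (φ ⇒ χ) (φ ⇒ ψ) ⨾
    ∘-cong (taut ((‵ 0 ⟹ ‵ 1) & (‵ 0 ⟹ ‵ 2) ⟺ (‵ 0 ⟹ ‵ 1 & ‵ 2)) (φ ∷ χ ∷ ψ ∷ []))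
    where ψ = ⋀ (χ' ∷ χs)

  -- φ is equivalent to ¬(¬(ψ ∧ φ) ∧ (φ → ψ)).
  Δ∧-Δ⇒-Δ : ∀ (ψ φ : Form P) → ⊢ (Δ (ψ ∧' φ) ∧' Δ (φ ⇒ ψ) ⇒ Δ φ)
  Δ∧-Δ⇒-Δ ψ φ =
    ∧-mapˡ (Δ-¬ (ψ ∧' φ)) ⨾ Δ-∧ (¬' (ψ ∧' φ)) (φ ⇒ ψ) ⨾ Δ-¬ _ ⨾
    Δ-cong (taut (~ (~ (‵ 0 & ‵ 1) & (‵ 1 ⟹ ‵ 0)) ⟺ ‵ 1) (ψ ∷ φ ∷ []))

  Δ∧-∘⇒-∨Δ : ∀ (ψ φ : Form P) → ⊢ (Δ (ψ ∧' φ) ∧' ∘ (φ ⇒ ψ) ⇒ φ ∨' Δ φ)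
  Δ∧-∘⇒-∨Δ ψ φ =
    MP (MP (taut ((‵ 0 & ‵ 1 ⟹ ‵ 2) ⟹ (‵ 3 & (‵ 4 ⟹ ‵ 5) ⟹ ‵ 1) ⟹ ‵ 0 & ‵ 3 ⟹ ‵ 4 ∨∨ ‵ 2)
                 (Δ (ψ ∧' φ) ∷ Δ (φ ⇒ ψ) ∷ Δ φ ∷ ∘ (φ ⇒ ψ) ∷ φ ∷ ψ ∷ []))
           (Δ∧-Δ⇒-Δ ψ φ))
       (∘∧⇒Δ (φ ⇒ ψ))

mainTheorem19 : {P : Set} → P → (n : ℕ) → (φ : Form P) → (χ : Vec (Form P) (suc n)) →
    ⊢ ((Δ (⋀ χ ⇒ φ) ∧' map⋀ (λ c → Δ c) χ ∧' map⋀ (λ c → ∘ (φ ⇒ c)) χ) ⇒ (φ ∨' Δ φ))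
mainTheorem19 _ _ φ χ = ⇒-∧ Δ[c∧φ] ∘[φ⇒c] ⨾ Δ∧-∘⇒-∨Δ c φ
  where
  c : Form _
  c = ⋀ χ

  H : Form _
  H = Δ (c ⇒ φ) ∧' map⋀ Δ_ χ ∧' map⋀ (λ χₖ → ∘ (φ ⇒ χₖ)) χ

  Δ[c∧φ] : ⊢ (H ⇒ Δ (c ∧' φ))
  Δ[c∧φ] = ⇒-∧ (∧-elimʳ ⨾ ∧-elimˡ ⨾ Δ-⋀ χ) ∧-elimˡ ⨾ Δ-∧ c (c ⇒ φ) ⨾
           Δ-cong (taut (‵ 0 & (‵ 0 ⟹ ‵ 1) ⟺ ‵ 0 & ‵ 1) (c ∷ φ ∷ []))

  ∘[φ⇒c] : ⊢ (H ⇒ ∘ (φ ⇒ c))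
  ∘[φ⇒c] = ∧-elimʳ ⨾ ∧-elimʳ ⨾ ∘⇒-⋀ φ χ
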